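{- There exist infinitely many positive integers $n$ such that for each of them there is a connected graph $G$ of order $n$ with maximum degree $\Delta(G)$ satisfying \[ \Psi_g^-(G) = \Psi_g^+(G) = \frac{\Delta(G)}{\Delta(G)+1}\, n. \]
   Context: For a set $S$ of vertices of a graph $G$, a vertex $v \in S$ is an enclave of $S$ if $N[v] \subseteq S$; $S$ is enclaveless if it contains no enclave. The competition-enclaveless game on $G$ is played by Maximizer and Minimizer, who alternately choose a vertex $v$ not in the set $S$ of previously chosen vertices such that $S\cup\{v\}$ is enclaveless; the game ends when no such vertex exists. Maximizer aims to maximize and Minimizer to minimize the final $|S|$. $\Psi_g^+(G)$ is the final $|S|$ when Maximizer moves first and both play optimally; $\Psi_g^-(G)$ is the same when Minimizer moves first. -}

module Defs where

open import Data.Nat using (ℕ; zero; suc; _+_; _⊔_; _⊓_)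
open import Data.Bool using (Bool; true; false; _∧_; _∨_; not; if_then_else_)
open import Data.Fin using (Fin)
open import Data.List using (List; []; _∷_; foldr; map; allFin; filterᵇ)
open import Data.Nat.ListAction using (sum)
open import Data.Bool.ListAction using (all; any)
open import Data.Vec using (lookup; replicate; _[_]≔_)
open import Data.Fin.Subset using (Subset)
open import Relation.Binary.PropositionalEquality using (_≡_)

record Graph (n : ℕ) : Set where
  field
    adj    : Fin n → Fin n → Bool
    sym    : ∀ u v → adj u v ≡ adj v u
    irrefl : ∀ v → adj v v ≡ false
open Graph public

module _ {n : ℕ} (G : Graph n) where

  data Walk : Fin n → Fin n → Set where
    here : ∀ {v} → Walk v v
    step : ∀ {u w v} → adj G u w ≡ true → Walk w v → Walk u v

  Connected : Set
  Connected = ∀ u v → Walk u v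

  degree : Fin n → ℕ
  degree v = sum (map (λ u → if adj G v u then 1 else 0) (allFin n))

  maxDegree : ℕ
  maxDegree = foldr (λ v acc → degree v ⊔ acc) 0 (allFin n)

  inS : Subset n → Fin n → Bool
  inS S v = lookup S v

  isEnclave : Subset n → Fin n → Bool
  isEnclave S v = inS S v ∧ all (λ u → not (adj G v u) ∨ inS S u) (allFin n)

  enclaveless : Subset n → Bool
  enclaveless S = not (any (isEnclave S) (allFin n))

  add : Subset n → Fin n → Subset n
  add S v = S [ v ]≔ true

  legalMoves : Subset n → List (Fin n)
  legalMoves S = filterᵇ (λ v → not (inS S v) ∧ enclaveless (add S v)) (allFin n)

  size : Subset n → ℕ
  size S = sum (map (λ v → if inS S v then 1 else 0) (allFin n))

  data Player : Set where
    Maximizer Minimizer : Player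

  -- game value with fuel (number of remaining moves allowed); fuel n suffices
  -- since every move adds a new vertex to S.
  value : ℕ → Player → Subset n → ℕ
  value zero p S = size S
  value (suc k) Maximizer S with legalMoves S
  ... | [] = size S
  ... | v ∷ vs = foldr (λ w acc → value k Minimizer (add S w) ⊔ acc)
                       (value k Minimizer (add S v)) vs
  value (suc k) Minimizer S with legalMoves S
  ... | [] = size S
  ... | v ∷ vs = foldr (λ w acc → value k Maximizer (add S w) ⊓ acc)
                       (value k Maximizer (add S v)) vs

  Ψ⁺ : ℕ
  Ψ⁺ = value n Maximizer (replicate n false)

  Ψ⁻ : ℕ
  Ψ⁻ = value n Minimizer (replicate n false)

-- In the complete graph K_n a vertex set is enclaveless exactly when it misses
-- some vertex, so a move is legal as long as at least two vertices are unchosen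
-- and no move is legal once only one is. Hence every play, whatever either
-- player does, ends with exactly n − 1 chosen vertices: Ψ⁺ = Ψ⁻ = n − 1, and
-- since Δ(K_n) = n − 1 this is Δ n / (Δ + 1).
module Submission where

open import Defs
open import Data.Nat using (ℕ; _≤_; _<_; _+_; _*_)
open import Data.Product using (Σ; _×_)
open import Relation.Binary.PropositionalEquality using (_≡_)

open import Algebra.Definitions (_≡_ {A = ℕ}) using (Idempotent)
open import Data.Bool using (Bool; true; false; T; T?; not; _∧_; _∨_; if_then_else_)
open import Data.Bool.Properties using (T-≡; T-not-≡; T-∧; ¬-not)
open import Data.Empty using (⊥-elim)
open import Data.Fin using (Fin; zero; suc; _≟_)
open import Data.Fin.Subset using (Subset; ⊤; ⊥; ⁅_⁆; ∁; ∣_∣; inside; outside)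
open import Data.Fin.Subset.Properties using (∣p∣≡n⇒p≡⊤; ∣⊥∣≡0; ∣∁p∣≡n∸∣p∣; ∣⁅x⁆∣≡1; x∈⁅x⁆; x∈⁅y⁆⇒x≡y)
open import Data.List using ([]; _∷_; foldr; map; tabulate; allFin)
open import Data.List.Properties using (map-tabulate)
open import Data.List.Membership.Propositional using (_∈_; lose)
open import Data.List.Membership.Propositional.Properties using (∈-allFin; ∈-filter⁺; ∈-filter⁻)
open import Data.List.Relation.Unary.All as All using (All; []; _∷_)
open import Data.List.Relation.Unary.All.Properties using (all⁺; all⁻)
open import Data.List.Relation.Unary.Any as Any using ()
open import Data.List.Relation.Unary.Any.Properties using (any⁺; any⁻)
open import Data.Nat using (zero; suc; _∸_; _⊔_; _⊓_; z≤n; s≤s)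
open import Data.Nat.ListAction using (sum)
open import Data.Bool.ListAction using (any)
open import Data.Nat.Properties using (+-suc; +-identityʳ; +-comm; m≤n+m; n≤1+n; suc-injective; ⊔-idem; ⊓-idem; ⊔-identityʳ)
open import Data.Product using (_,_; proj₁; proj₂; ∃)
open import Data.Vec using ([]; _∷_; lookup; _[_]≔_)
open import Data.Vec.Properties using (lookup-map; lookup-replicate; []=⇒lookup; lookup⇒[]=)
open import Function using (_∘_; id)
open import Function.Bundles using (module Equivalence)
open import Relation.Binary.PropositionalEquality as ≡ using (_≢_; refl; trans; cong; cong₂; subst; module ≡-Reasoning)
open import Relation.Nullary using (¬_; yes; no; contradiction)

open Equivalence using (to; from)
open ≡-Reasoning

sum-indicator≡∣p∣ : ∀ {n} (p : Subset n) →
  sum (map (λ v → if lookup p v then 1 else 0) (allFin n)) ≡ ∣ p ∣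
sum-indicator≡∣p∣ p =
  trans (cong sum (map-tabulate id (λ v → if lookup p v then 1 else 0))) (sum-tabulate p)
  where
  sum-tabulate : ∀ {n} (p : Subset n) → sum (tabulate (λ v → if lookup p v then 1 else 0)) ≡ ∣ p ∣
  sum-tabulate []            = refl
  sum-tabulate (inside ∷ p)  = cong suc (sum-tabulate p)
  sum-tabulate (outside ∷ p) = sum-tabulate p

∣p∣<n⇒∃outside : ∀ {n} (p : Subset n) → ∣ p ∣ < n → ∃ λ x → lookup p x ≡ outside
∣p∣<n⇒∃outside (outside ∷ p) _        = zero , refl
∣p∣<n⇒∃outside (inside ∷ p)  (s≤s lt) with ∣p∣<n⇒∃outside p lt
... | x , px = suc x , px

∣p[x]≔inside∣≡1+∣p∣ : ∀ {n} (p : Subset n) x → lookup p x ≡ outside →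
  ∣ p [ x ]≔ inside ∣ ≡ suc ∣ p ∣
∣p[x]≔inside∣≡1+∣p∣ (outside ∷ p) zero    refl = refl
∣p[x]≔inside∣≡1+∣p∣ (inside ∷ p)  (suc x) px   = cong suc (∣p[x]≔inside∣≡1+∣p∣ p x px)
∣p[x]≔inside∣≡1+∣p∣ (outside ∷ p) (suc x) px   = ∣p[x]≔inside∣≡1+∣p∣ p x px

record Unchosen {n} (k : ℕ) (S : Subset n) : Set where
  constructor unchosen
  field
    k+∣S∣≡n : k + ∣ S ∣ ≡ n

Unchosen-add : ∀ {n k} {S : Subset n} {w} → lookup S w ≡ outside → Unchosen (suc k) S →
  Unchosen k (S [ w ]≔ inside)
Unchosen-add {n} {k} {S} {w} w∉S (unchosen eq) = unchosen (begin
  k + ∣ S [ w ]≔ inside ∣ ≡⟨ cong (k +_) (∣p[x]≔inside∣≡1+∣p∣ S w w∉S) ⟩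
  k + suc ∣ S ∣           ≡⟨ +-suc k ∣ S ∣ ⟩
  suc k + ∣ S ∣           ≡⟨ eq ⟩
  n                       ∎)

Unchosen⇒∃outside : ∀ {n k} {S : Subset n} → Unchosen (suc k) S → ∃ λ w → lookup S w ≡ outside
Unchosen⇒∃outside {k = k} {S} (unchosen eq) =
  ∣p∣<n⇒∃outside S (subst (∣ S ∣ <_) eq (s≤s (m≤n+m ∣ S ∣ k)))

lookup-⁅⁆-comm : ∀ {n} (u v : Fin n) → lookup ⁅ u ⁆ v ≡ lookup ⁅ v ⁆ u
lookup-⁅⁆-comm zero    zero    = refl
lookup-⁅⁆-comm zero    (suc v) = lookup-replicate v outside
lookup-⁅⁆-comm (suc u) zero    = ≡.sym (lookup-replicate u outside)
lookup-⁅⁆-comm (suc u) (suc v) = lookup-⁅⁆-comm u v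

lookup-⁅⁆-≢ : ∀ {n} {u v : Fin n} → u ≢ v → lookup ⁅ u ⁆ v ≡ outside
lookup-⁅⁆-≢ {u = u} {v} u≢v =
  ¬-not (u≢v ∘ ≡.sym ∘ x∈⁅y⁆⇒x≡y u ∘ lookup⇒[]= v ⁅ u ⁆)

foldr-⊔-const : ∀ {A : Set} (f : A → ℕ) {c} → (∀ x → f x ≡ c) →
  ∀ x xs → foldr (λ y acc → f y ⊔ acc) 0 (x ∷ xs) ≡ c
foldr-⊔-const f     fc x []       = trans (⊔-identityʳ (f x)) (fc x)
foldr-⊔-const f {c} fc x (y ∷ ys) =
  trans (cong₂ _⊔_ (fc x) (foldr-⊔-const f fc y ys)) (⊔-idem c)

foldr-idem-const : ∀ {A : Set} (_∙_ : ℕ → ℕ → ℕ) → Idempotent _∙_ →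
  (f : A → ℕ) → ∀ {c v vs} → All (λ w → f w ≡ c) (v ∷ vs) →
  foldr (λ w acc → f w ∙ acc) (f v) vs ≡ c
foldr-idem-const _∙_ idem f     (fv ∷ [])        = fv
foldr-idem-const _∙_ idem f {c} (fv ∷ fw ∷ fws) =
  trans (cong₂ _∙_ fw (foldr-idem-const _∙_ idem f (fv ∷ fws))) (idem c)

maxDegree-regular : ∀ {n} (G : Graph (suc n)) {d} → (∀ v → degree G v ≡ d) → maxDegree G ≡ d
maxDegree-regular G reg = foldr-⊔-const (degree G) reg zero (tabulate suc)

module _ {n : ℕ} (G : Graph n) where

  private
    legal : Subset n → Fin n → Bool
    legal S v = not (inS G S v) ∧ enclaveless G (add G S v)

  enclave⇒¬enclaveless : ∀ {S v} → T (isEnclave G S v) → ¬ T (enclaveless G S)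
  enclave⇒¬enclaveless {S} {v} enclave encl =
    subst T (to T-not-≡ encl) (any⁺ (isEnclave G S) (lose (∈-allFin v) enclave))

  noEnclave⇒enclaveless : ∀ {S} → (∀ v → ¬ T (isEnclave G S v)) → T (enclaveless G S)
  noEnclave⇒enclaveless {S} noEnclave = from T-not-≡ (¬-not someEnclave)
    where
    someEnclave : ¬ any (isEnclave G S) (allFin n) ≡ true
    someEnclave anyEnclave
      with Any.satisfied (any⁻ (isEnclave G S) (allFin n) (from T-≡ anyEnclave))
    ... | v , enclave = noEnclave v enclave

  ¬enclaveless-⊤ : Fin n → ¬ T (enclaveless G ⊤)
  ¬enclaveless-⊤ v = enclave⇒¬enclaveless {⊤} {v} (from T-∧ (∈⊤ v , all⁻ closedᵇ allClosed))
    where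
    ∈⊤ : ∀ u → T (lookup ⊤ u)
    ∈⊤ u = subst T (≡.sym (lookup-replicate u inside)) _
    closedᵇ : Fin n → Bool
    closedᵇ u = not (adj G v u) ∨ lookup ⊤ u
    closed : ∀ u → T (closedᵇ u)
    closed u with adj G v u
    ... | true  = ∈⊤ u
    ... | false = _
    allClosed : All (T ∘ closedᵇ) (allFin n)
    allClosed = All.universal closed (allFin n)

  ∈-legalMoves⁻ : ∀ {S w} → w ∈ legalMoves G S →
    lookup S w ≡ outside × T (enclaveless G (add G S w))
  ∈-legalMoves⁻ {S} {w} w∈
    with to (T-∧ {not (lookup S w)}) (proj₂ (∈-filter⁻ (T? ∘ legal S) {xs = allFin n} w∈))
  ... | w∉S , encl = to T-not-≡ w∉S , encl

  ∈-legalMoves⁺ : ∀ {S w} → lookup S w ≡ outside → T (enclaveless G (add G S w)) →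
    w ∈ legalMoves G S
  ∈-legalMoves⁺ {S} {w} w∉S encl =
    ∈-filter⁺ (T? ∘ legal S) (∈-allFin w) (from T-∧ (from T-not-≡ w∉S , encl))

  lastVertex⇒noLegalMoves : ∀ {S} → suc ∣ S ∣ ≡ n → legalMoves G S ≡ []
  lastVertex⇒noLegalMoves {S} last with legalMoves G S in moves
  ... | []    = refl
  ... | w ∷ _ with ∈-legalMoves⁻ {S} (subst (w ∈_) (≡.sym moves) (Any.here refl))
  ...   | w∉S , encl = ⊥-elim (¬enclaveless-⊤ w (subst (T ∘ enclaveless G) full encl))
    where
    full : add G S w ≡ ⊤
    full = ∣p∣≡n⇒p≡⊤ (trans (∣p[x]≔inside∣≡1+∣p∣ S w w∉S) last)

-- Inv d S says that every play from S lasts exactly d more moves.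
module _ {n : ℕ} (G : Graph n) (Inv : ℕ → Subset n → Set) (c : ℕ)
  (stuck   : ∀ {S} → Inv 0 S → legalMoves G S ≡ [] × size G S ≡ c)
  (live    : ∀ {d S} → Inv (suc d) S → legalMoves G S ≢ [])
  (advance : ∀ {d S w} → Inv (suc d) S → w ∈ legalMoves G S → Inv d (add G S w))
  where

  private
    finalSize : ∀ {d S} → Inv d S → legalMoves G S ≡ [] → size G S ≡ c
    finalSize {zero}  inv _    = proj₂ (stuck inv)
    finalSize {suc d} inv none = contradiction none (live inv)

  value-forced : ∀ k {d} p S → d ≤ k → Inv d S → value G k p S ≡ c
  replies-forced : ∀ k {d} p S {v vs} → d ≤ suc k → Inv d S → legalMoves G S ≡ v ∷ vs →
    All (λ w → value G k p (add G S w) ≡ c) (v ∷ vs)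

  value-forced zero p S z≤n inv = proj₂ (stuck inv)
  value-forced (suc k) Maximizer S d≤k inv with legalMoves G S in moves
  ... | []     = finalSize inv moves
  ... | v ∷ vs = foldr-idem-const _⊔_ ⊔-idem (λ w → value G k Minimizer (add G S w))
                   (replies-forced k Minimizer S d≤k inv moves)
  value-forced (suc k) Minimizer S d≤k inv with legalMoves G S in moves
  ... | []     = finalSize inv moves
  ... | v ∷ vs = foldr-idem-const _⊓_ ⊓-idem (λ w → value G k Maximizer (add G S w))
                   (replies-forced k Maximizer S d≤k inv moves)

  replies-forced k {zero} p S _ inv moves =
    contradiction (trans (≡.sym moves) (proj₁ (stuck inv))) λ ()
  replies-forced k {suc d} p S (s≤s d≤k) inv moves = All.tabulate λ w∈ →
    value-forced k p _ d≤k (advance inv (subst (_ ∈_) (≡.sym moves) w∈))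

complete : ∀ n → Graph n
complete n = record
  { adj    = λ u v → lookup (∁ ⁅ u ⁆) v
  ; sym    = λ u v → begin
      lookup (∁ ⁅ u ⁆) v   ≡⟨ lookup-map v not ⁅ u ⁆ ⟩
      not (lookup ⁅ u ⁆ v) ≡⟨ cong not (lookup-⁅⁆-comm u v) ⟩
      not (lookup ⁅ v ⁆ u) ≡⟨ lookup-map u not ⁅ v ⁆ ⟨
      lookup (∁ ⁅ v ⁆) u   ∎
  ; irrefl = λ v → trans (lookup-map v not ⁅ v ⁆) (cong not ([]=⇒lookup (x∈⁅x⁆ v)))
  }

module _ {n : ℕ} where

  complete-adjacent : ∀ {u v : Fin n} → u ≢ v → adj (complete n) u v ≡ true
  complete-adjacent {u} {v} u≢v = trans (lookup-map v not ⁅ u ⁆) (cong not (lookup-⁅⁆-≢ u≢v))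

  complete-connected : Connected (complete n)
  complete-connected u v with u ≟ v
  ... | yes refl = here
  ... | no u≢v   = step (complete-adjacent u≢v) here

  degree-complete : ∀ v → degree (complete n) v ≡ n ∸ 1
  degree-complete v = begin
    degree (complete n) v ≡⟨ sum-indicator≡∣p∣ (∁ ⁅ v ⁆) ⟩
    ∣ ∁ ⁅ v ⁆ ∣           ≡⟨ ∣∁p∣≡n∸∣p∣ ⁅ v ⁆ ⟩
    n ∸ ∣ ⁅ v ⁆ ∣         ≡⟨ cong (n ∸_) (∣⁅x⁆∣≡1 v) ⟩
    n ∸ 1                 ∎

  complete-enclave⇒⊤ : ∀ {S v} → T (isEnclave (complete n) S v) → ∀ u → T (lookup S u)
  complete-enclave⇒⊤ {S} {v} enclave u with to (T-∧ {lookup S v}) enclave | v ≟ u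
  ... | v∈S , _      | yes refl = v∈S
  ... | _   , closed | no v≢u   =
    subst (λ b → T (not b ∨ lookup S u)) (complete-adjacent v≢u)
      (All.lookup (all⁺ (λ x → not (adj (complete n) v x) ∨ lookup S x) (allFin n) closed)
        (∈-allFin u))

  complete-enclaveless : ∀ {S u} → lookup S u ≡ outside → T (enclaveless (complete n) S)
  complete-enclaveless {S} {u} u∉S =
    noEnclave⇒enclaveless (complete n) {S} λ v enclave →
      subst T u∉S (complete-enclave⇒⊤ {S} {v} enclave u)

value-complete : ∀ m p → value (complete (suc m)) (suc m) p ⊥ ≡ m
value-complete m p =
  value-forced K (λ d → Unchosen (suc d)) m stuck live advance (suc m) p ⊥ (n≤1+n m) start
  where
  K : Graph (suc m)
  K = complete (suc m)

  stuck : ∀ {S : Subset (suc m)} → Unchosen 1 S → legalMoves K S ≡ [] × size K S ≡ m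
  stuck {S} (unchosen last) =
    lastVertex⇒noLegalMoves K {S} last , trans (sum-indicator≡∣p∣ S) (suc-injective last)

  live : ∀ {d} {S : Subset (suc m)} → Unchosen (suc (suc d)) S → legalMoves K S ≢ []
  live {S = S} inv none with Unchosen⇒∃outside inv
  ... | w , w∉S with Unchosen⇒∃outside (Unchosen-add w∉S inv)
  ...   | u , u∉S′
    with subst (w ∈_) none (∈-legalMoves⁺ K {S} w∉S (complete-enclaveless {S = add K S w} u∉S′))
  ... | ()

  advance : ∀ {d} {S : Subset (suc m)} {w} → Unchosen (suc (suc d)) S → w ∈ legalMoves K S →
    Unchosen (suc d) (add K S w)
  advance {S = S} inv w∈ = Unchosen-add (proj₁ (∈-legalMoves⁻ K {S} w∈)) inv

  start : Unchosen (suc m) ⊥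
  start = unchosen (trans (cong (suc m +_) (∣⊥∣≡0 (suc m))) (+-identityʳ (suc m)))

maxDegree-complete : ∀ m → maxDegree (complete (suc m)) ≡ m
maxDegree-complete m = maxDegree-regular (complete (suc m)) degree-complete

proposition3p3 : ∀ (m : ℕ) → Σ ℕ λ n → m ≤ n × 0 < n × Σ (Graph n) λ G →
    Connected G × Ψ⁻ G ≡ Ψ⁺ G × Ψ⁺ G * (maxDegree G + 1) ≡ maxDegree G * n
proposition3p3 m =
  suc m , n≤1+n m , s≤s z≤n , K , complete-connected ,
  trans (value-complete m Minimizer) (≡.sym (value-complete m Maximizer)) , balance
  where
  K : Graph (suc m)
  K = complete (suc m)

  balance : Ψ⁺ K * (maxDegree K + 1) ≡ maxDegree K * suc m
  balance = begin
    Ψ⁺ K * (maxDegree K + 1) ≡⟨ cong₂ (λ ψ Δ → ψ * (Δ + 1))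
                                      (value-complete m Maximizer) (maxDegree-complete m) ⟩
    m * (m + 1)              ≡⟨ cong (m *_) (+-comm m 1) ⟩
    m * suc m                ≡⟨ cong (_* suc m) (maxDegree-complete m) ⟨
    maxDegree K * suc m      ∎
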